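{- Let $n\ge 2$ and $0\le i<n$, and let $T_i=\{(r,r+i,2r+i): 0\le r\le n-1\}$ (coordinates mod $n$) be the $i$th right diagonal of $L_{\mathbb Z_n}$, with $T_{i+1}$ defined with $i+1$ taken mod $n$. Then the subgraph of $\Gamma(L_{\mathbb Z_n})$ induced by $T_i\cup T_{i+1}$ is isomorphic to the Möbius ladder of order $2n$, with rim the cycle formed by its row and column edges. Moreover, if $n=2m$ is even, then every cell $x\in T_i$ is nearly antipodal (in this Möbius ladder) to each of the cells $x'=x+(m,m+1,1)$ and $x''=x+(m-1,m,-1)$ (addition coordinatewise mod $n$).
   Context: The circulant Latin square of order $n$ is $L_{\mathbb Z_n}=\{(r,c,s)\in\mathbb Z_n^3: s\equiv r+c\pmod n\}$, a cell being written as a triple (row, column, symbol). The Latin square graph $\Gamma(\mathbf L)$ of a Latin square $\mathbf L$ has the cells as vertices, distinct cells $(r,c,s),(r',c',s')$ being adjacent if exactly one of $r=r'$, $c=c'$, $s=s'$ holds; such an edge is a row edge, column edge, or symbol edge respectively. The Möbius ladder of order $2n$ is the cubic graph obtained from a cycle $C$ (the rim) of length $2n$ by adding $n$ edges (rungs) each joining a pair of vertices at distance $n$ on $C$. Two vertices are nearly antipodal if they are at distance $n-1$ along the rim $C$. -}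

module Defs where

open import Data.Nat using (ℕ; zero; suc; _+_; _∸_; _⊓_; NonZero)
open import Data.Nat.DivMod using (_mod_)
open import Data.Fin using (Fin; toℕ)
open import Data.Product using (Σ; ∃; _×_; _,_; proj₁; proj₂)
open import Data.Sum using (_⊎_)
open import Relation.Binary.PropositionalEquality using (_≡_)
open import Relation.Nullary using (¬_)

nz+ : ∀ n → .{{_ : NonZero n}} → NonZero (n + n)
nz+ (suc n) = _

_⊕_ : ∀ {n} .{{_ : NonZero n}} → Fin n → Fin n → Fin n
_⊕_ {n} a b = (toℕ a + toℕ b) mod n

[_] : ∀ {n} .{{_ : NonZero n}} → ℕ → Fin n
[_] {n} a = a mod n

Cell : ℕ → Set
Cell n = Fin n × Fin n × Fin n

row col sym : ∀ {n} → Cell n → Fin n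
row x = proj₁ x
col x = proj₁ (proj₂ x)
sym x = proj₂ (proj₂ x)

InL : ∀ {n} .{{_ : NonZero n}} → Cell n → Set
InL x = sym x ≡ row x ⊕ col x

_⊕c_ : ∀ {n} .{{_ : NonZero n}} → Cell n → Cell n → Cell n
(r , c , s) ⊕c (r' , c' , s') = (r ⊕ r' , c ⊕ c' , s ⊕ s')

diagCell : ∀ {n} .{{_ : NonZero n}} → Fin n → Fin n → Cell n
diagCell i r = (r , r ⊕ i , (r ⊕ r) ⊕ i)

InT : ∀ {n} .{{_ : NonZero n}} → Fin n → Cell n → Set
InT i x = ∃ λ r → x ≡ diagCell i r

RowEdge ColEdge SymEdge : ∀ {n} → Cell n → Cell n → Set
RowEdge x y = row x ≡ row y × ¬ col x ≡ col y × ¬ sym x ≡ sym y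
ColEdge x y = ¬ row x ≡ row y × col x ≡ col y × ¬ sym x ≡ sym y
SymEdge x y = ¬ row x ≡ row y × ¬ col x ≡ col y × sym x ≡ sym y

-- adjacency in Γ(L) (both cells assumed to be cells of L)
Adj : ∀ {n} → Cell n → Cell n → Set
Adj x y = ¬ x ≡ y × (RowEdge x y ⊎ ColEdge x y ⊎ SymEdge x y)

RowColEdge : ∀ {n} → Cell n → Cell n → Set
RowColEdge x y = ¬ x ≡ y × (RowEdge x y ⊎ ColEdge x y)

module _ (n : ℕ) .{{_ : NonZero n}} where

  private
    N : ℕ
    N = n + n

  modN : ℕ → Fin (n + n)
  modN a = _mod_ a (n + n) {{nz+ n}}

  Rim : Fin (n + n) → Fin (n + n) → Set
  Rim j k = k ≡ modN (toℕ j + 1) ⊎ j ≡ modN (toℕ k + 1)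

  Rung : Fin (n + n) → Fin (n + n) → Set
  Rung j k = k ≡ modN (toℕ j + n)

  MLAdj : Fin (n + n) → Fin (n + n) → Set
  MLAdj j k = Rim j k ⊎ Rung j k

  rimDist : Fin (n + n) → Fin (n + n) → ℕ
  rimDist j k = d ⊓ (N ∸ d)
    where
      d : ℕ
      d = toℕ (modN (toℕ k + (N ∸ toℕ j)))

  NearlyAntipodal : Fin (n + n) → Fin (n + n) → Set
  NearlyAntipodal j k = rimDist j k ≡ n ∸ 1

module Submission where

-- Number the cells of T_i ∪ T_{i+1} by a ∈ Z_{2n}: the cell of a is (⌊a/2⌋, ⌈a/2⌉ + i, a + i),
-- so even a = 2r runs through T_i and odd a = 2r+1 through T_{i+1}. Moving from a to a+1 keeps the
-- row (a even) or the column (a odd) and changes the other two coordinates, so row and column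
-- edges form the rim; moving from a to a+n keeps the symbol, giving the rungs. Conversely, for
-- 0 ≤ a, b < 2n a coordinate can agree only in these cases: ⌊a/2⌋ and ⌈a/2⌉ lie in [0, n], so
-- they agree mod n only for neighbouring a, b (or for 0 and 2n-1 in the column), and a + i ≡ b + i
-- forces b = a ± n. For n = 2m and x = cell of 2r, x + (m, m+1, 1) and x + (m-1, m, -1) are the
-- cells of 2r + n + 1 and 2r + n - 1, which are at rim distance n - 1 from 2r.

open import Data.Fin using (Fin; toℕ)
open import Data.Fin.Properties using (toℕ-injective; toℕ-fromℕ<; toℕ<n; fromℕ<-cong; fromℕ<-injective)
open import Data.Nat using (ℕ; zero; suc; _+_; _*_; _∸_; _≤_; _<_; _⊓_; _%_; _/_; ⌊_/2⌋; ⌈_/2⌉; s≤s)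
open import Data.Nat using (NonZero; >-nonZero⁻¹)
open import Data.Nat.DivMod
open import Data.Nat.Properties
open import Data.Nat.Tactic.RingSolver using (solve-∀)
open import Data.Product using (Σ; ∃; _×_; _,_; proj₁; proj₂; uncurry)
open import Data.Sum using (_⊎_; inj₁; inj₂; [_,_]′)
import Data.Sum as Sum
open import Function using (_∘_; id)
open import Function.Bundles using (_⇔_; mk⇔)
open import Relation.Nullary using (¬_; yes; no; contradiction)
open import Relation.Binary.PropositionalEquality hiding ([_])

open import Defs renaming (sym to symbol)

data Parity : ℕ → Set where
  even : ∀ r → Parity (r + r)
  odd  : ∀ r → Parity (suc (r + r))

parity : ∀ a → Parity a
parity zero = even 0
parity (suc a) with parity a
... | even r = odd r
... | odd r  = subst Parity (cong suc (+-suc r r)) (even (suc r))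

⌈n/2⌉≡⌊n/2⌋⊎⌈n/2⌉≡1+⌊n/2⌋ : ∀ n → ⌈ n /2⌉ ≡ ⌊ n /2⌋ ⊎ ⌈ n /2⌉ ≡ suc ⌊ n /2⌋
⌈n/2⌉≡⌊n/2⌋⊎⌈n/2⌉≡1+⌊n/2⌋ zero          = inj₁ refl
⌈n/2⌉≡⌊n/2⌋⊎⌈n/2⌉≡1+⌊n/2⌋ (suc zero)    = inj₂ refl
⌈n/2⌉≡⌊n/2⌋⊎⌈n/2⌉≡1+⌊n/2⌋ (suc (suc n)) =
  Sum.map (cong suc) (cong suc) (⌈n/2⌉≡⌊n/2⌋⊎⌈n/2⌉≡1+⌊n/2⌋ n)

⌊m/2⌋≡⌊n/2⌋⇒m≡n⊎n≡1+m⊎m≡1+n : ∀ m n → ⌊ m /2⌋ ≡ ⌊ n /2⌋ → m ≡ n ⊎ n ≡ suc m ⊎ m ≡ suc n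
⌊m/2⌋≡⌊n/2⌋⇒m≡n⊎n≡1+m⊎m≡1+n zero          zero          _  = inj₁ refl
⌊m/2⌋≡⌊n/2⌋⇒m≡n⊎n≡1+m⊎m≡1+n zero          (suc zero)    _  = inj₂ (inj₁ refl)
⌊m/2⌋≡⌊n/2⌋⇒m≡n⊎n≡1+m⊎m≡1+n (suc zero)    zero          _  = inj₂ (inj₂ refl)
⌊m/2⌋≡⌊n/2⌋⇒m≡n⊎n≡1+m⊎m≡1+n (suc zero)    (suc zero)    _  = inj₁ refl
⌊m/2⌋≡⌊n/2⌋⇒m≡n⊎n≡1+m⊎m≡1+n (suc (suc m)) (suc (suc n)) eq =
  Sum.map (cong (suc ∘ suc)) (Sum.map (cong (suc ∘ suc)) (cong (suc ∘ suc)))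
    (⌊m/2⌋≡⌊n/2⌋⇒m≡n⊎n≡1+m⊎m≡1+n m n (suc-injective eq))
⌊m/2⌋≡⌊n/2⌋⇒m≡n⊎n≡1+m⊎m≡1+n zero          (suc (suc n)) ()
⌊m/2⌋≡⌊n/2⌋⇒m≡n⊎n≡1+m⊎m≡1+n (suc zero)    (suc (suc n)) ()
⌊m/2⌋≡⌊n/2⌋⇒m≡n⊎n≡1+m⊎m≡1+n (suc (suc m)) zero          ()
⌊m/2⌋≡⌊n/2⌋⇒m≡n⊎n≡1+m⊎m≡1+n (suc (suc m)) (suc zero)    ()

⌊[n+n]+m/2⌋≡n+⌊m/2⌋ : ∀ n m → ⌊ (n + n) + m /2⌋ ≡ n + ⌊ m /2⌋
⌊[n+n]+m/2⌋≡n+⌊m/2⌋ zero    m = refl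
⌊[n+n]+m/2⌋≡n+⌊m/2⌋ (suc n) m rewrite +-suc n n = cong suc (⌊[n+n]+m/2⌋≡n+⌊m/2⌋ n m)

⌊m+n/2⌋≤⌊m/2⌋+n : ∀ m n → ⌊ m + n /2⌋ ≤ ⌊ m /2⌋ + n
⌊m+n/2⌋≤⌊m/2⌋+n zero          n = ⌊n/2⌋≤n n
⌊m+n/2⌋≤⌊m/2⌋+n (suc zero)    n = ⌈n/2⌉≤n n
⌊m+n/2⌋≤⌊m/2⌋+n (suc (suc m)) n = s≤s (⌊m+n/2⌋≤⌊m/2⌋+n m n)

⌊m/2⌋<⌊m+n/2⌋<⌊m/2⌋+n : ∀ m {n} → 2 ≤ n → ⌊ m /2⌋ < ⌊ m + n /2⌋ × ⌊ m + n /2⌋ < ⌊ m /2⌋ + n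
⌊m/2⌋<⌊m+n/2⌋<⌊m/2⌋+n m (s≤s (s≤s {n = d} _))
  rewrite +-suc m (suc d) | +-suc m d | +-suc ⌊ m /2⌋ (suc d) | +-suc ⌊ m /2⌋ d =
  s≤s (⌊n/2⌋-mono (m≤m+n m d)) , s≤s (s≤s (⌊m+n/2⌋≤⌊m/2⌋+n m d))

m≤n+n⇒⌊m/2⌋≤n : ∀ {m n} → m ≤ n + n → ⌊ m /2⌋ ≤ n
m≤n+n⇒⌊m/2⌋≤n {m} {n} m≤2n = subst (⌊ m /2⌋ ≤_) (sym (n≡⌊n+n/2⌋ n)) (⌊n/2⌋-mono m≤2n)

m<n+n⇒⌊m/2⌋<n : ∀ {m n} → m < n + n → ⌊ m /2⌋ < n
m<n+n⇒⌊m/2⌋<n {m} {n} m<2n =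
  subst (⌊ suc (suc m) /2⌋ ≤_) (sym (n≡⌈n+n/2⌉ n)) (⌊n/2⌋-mono (s≤s m<2n))

⌊n/2⌋+⌊n/2⌋≤n : ∀ n → ⌊ n /2⌋ + ⌊ n /2⌋ ≤ n
⌊n/2⌋+⌊n/2⌋≤n n =
  subst (⌊ n /2⌋ + ⌊ n /2⌋ ≤_) (⌊n/2⌋+⌈n/2⌉≡n n) (+-monoʳ-≤ ⌊ n /2⌋ (⌊n/2⌋≤⌈n/2⌉ n))

⌈n/2⌉≡0⇒n≡0 : ∀ n → ⌈ n /2⌉ ≡ 0 → n ≡ 0
⌈n/2⌉≡0⇒n≡0 zero _ = refl

⌈n/2⌉≡⌈m/2⌉+k⇒m≡0×1+n≡k+k : ∀ {m n k} → n < k + k → ⌈ n /2⌉ ≡ ⌈ m /2⌉ + k → m ≡ 0 × suc n ≡ k + k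
⌈n/2⌉≡⌈m/2⌉+k⇒m≡0×1+n≡k+k {m} {n} {k} n<2k eq = m≡0 , ≤-antisym n<2k 2k≤1+n
  where
  ⌈n/2⌉≤k : ⌈ n /2⌉ ≤ k
  ⌈n/2⌉≤k = m≤n+n⇒⌊m/2⌋≤n n<2k
  ⌈m/2⌉≡0 : ⌈ m /2⌉ ≡ 0
  ⌈m/2⌉≡0 = n≤0⇒n≡0 (+-cancelʳ-≤ k ⌈ m /2⌉ 0 (subst (_≤ k) eq ⌈n/2⌉≤k))
  m≡0 : m ≡ 0
  m≡0 = ⌈n/2⌉≡0⇒n≡0 m ⌈m/2⌉≡0
  2k≤1+n : k + k ≤ suc n
  2k≤1+n = subst (λ h → h + h ≤ suc n) (trans eq (cong (_+ k) ⌈m/2⌉≡0)) (⌊n/2⌋+⌊n/2⌋≤n (suc n))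

module _ {n : ℕ} .{{_ : NonZero n}} where

  %-absorbˡ : ∀ x y → (x % n + y) % n ≡ (x + y) % n
  %-absorbˡ x y = begin
    (x % n + y) % n          ≡⟨ %-distribˡ-+ (x % n) y n ⟩
    (x % n % n + y % n) % n  ≡⟨ cong (λ r → (r + y % n) % n) (m%n%n≡m%n x n) ⟩
    (x % n + y % n) % n      ≡⟨ %-distribˡ-+ x y n ⟨
    (x + y) % n              ∎
    where open ≡-Reasoning

  %-injective-window : ∀ {x y} → x ≤ y → y < x + n → x % n ≡ y % n → x ≡ y
  %-injective-window {x} {y} x≤y y<x+n eq with m≤n⇒m<n∨m≡n (/-monoˡ-≤ n x≤y)
  ... | inj₂ x/n≡y/n = begin
    x                  ≡⟨ m≡m%n+[m/n]*n x n ⟩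
    x % n + x / n * n  ≡⟨ cong₂ (λ r q → r + q * n) eq x/n≡y/n ⟩
    y % n + y / n * n  ≡⟨ m≡m%n+[m/n]*n y n ⟨
    y                  ∎
    where open ≡-Reasoning
  ... | inj₁ x/n<y/n = contradiction y<x+n (≤⇒≯ (begin
    x + n                    ≡⟨ cong (_+ n) (m≡m%n+[m/n]*n x n) ⟩
    x % n + x / n * n + n    ≡⟨ cong (λ r → r + x / n * n + n) eq ⟩
    y % n + x / n * n + n    ≡⟨ +-assoc (y % n) _ n ⟩
    y % n + (x / n * n + n)  ≡⟨ cong (y % n +_) (+-comm _ n) ⟩
    y % n + suc (x / n) * n  ≤⟨ +-monoʳ-≤ (y % n) (*-monoˡ-≤ n x/n<y/n) ⟩
    y % n + y / n * n        ≡⟨ m≡m%n+[m/n]*n y n ⟨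
    y                        ∎))
    where open ≤-Reasoning

  []-injective : ∀ {x y} → [ x ] ≡ [ y ] → x % n ≡ y % n
  []-injective {x} {y} = fromℕ<-injective (x % n) (y % n) (m%n<n x n) (m%n<n y n)

  []-cong : ∀ {x y} → x % n ≡ y % n → [ x ] ≡ [ y ]
  []-cong {x} {y} eq = fromℕ<-cong (x % n) (y % n) eq (m%n<n x n) (m%n<n y n)

  toℕ[] : ∀ x → toℕ ([_] {n} x) ≡ x % n
  toℕ[] x = toℕ-fromℕ< (m%n<n x n)

  toℕ≡%⇒≡[] : ∀ (k : Fin n) x → toℕ k ≡ x % n → k ≡ [ x ]
  toℕ≡%⇒≡[] k x eq = toℕ-injective (trans eq (sym (toℕ[] x)))

  [toℕ] : ∀ (a : Fin n) → [ toℕ a ] ≡ a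
  [toℕ] a = sym (toℕ≡%⇒≡[] a (toℕ a) (sym (m<n⇒m%n≡m (toℕ<n a))))

  []-+ : ∀ x y → [ x ] ⊕ [ y ] ≡ [ x + y ]
  []-+ x y = []-cong (begin
    (toℕ ([_] {n} x) + toℕ ([_] {n} y)) % n  ≡⟨ cong₂ (λ a b → (a + b) % n) (toℕ[] x) (toℕ[] y) ⟩
    (x % n + y % n) % n                      ≡⟨ %-distribˡ-+ x y n ⟨
    (x + y) % n                              ∎)
    where open ≡-Reasoning

  []-+n : ∀ x → [ x + n ] ≡ [ x ]
  []-+n x = []-cong ([m+n]%n≡m%n x n)

  []-*n+ : ∀ q x → [ q * n + x ] ≡ [ x ]
  []-*n+ q x = []-cong (trans (cong (_% n) (+-comm (q * n) x)) ([m+kn]%n≡m%n x q n))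

  []-injective-within-period : ∀ {x y} → x < y + n → y < x + n → [ x ] ≡ [ y ] → x ≡ y
  []-injective-within-period {x} {y} x<y+n y<x+n eq with ≤-total x y
  ... | inj₁ x≤y = %-injective-window x≤y y<x+n ([]-injective eq)
  ... | inj₂ y≤x = sym (%-injective-window y≤x x<y+n ([]-injective (sym eq)))

  []-injective-below : ∀ {x y} → x < n → y < n → [ x ] ≡ [ y ] → x ≡ y
  []-injective-below {x} {y} x<n y<n =
    []-injective-within-period (≤-trans x<n (m≤n+m n y)) (≤-trans y<n (m≤n+m n x))

  []-+-cancelʳ : ∀ {x y} t → [ x + t ] ≡ [ y + t ] → [ x ] ≡ [ y ]
  []-+-cancelʳ {x} {y} t eq = []-cong (+-cancelʳ-≡ t (x % n) (y % n)
    ([]-injective-within-period (window x y) (window y x)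
      ([]-cong (trans (%-absorbˡ x t) (trans ([]-injective eq) (sym (%-absorbˡ y t)))))))
    where
    window : ∀ u v → u % n + t < v % n + t + n
    window u v = <-≤-trans (+-monoˡ-< t (m%n<n u n))
      (subst (_≤ v % n + t + n) (+-comm t n) (+-monoˡ-≤ n (m≤n+m t (v % n))))

  []-beyond-one-period : ∀ {x y} → x + n ≤ y → y < x + n + n → [ x ] ≡ [ y ] → y ≡ x + n
  []-beyond-one-period {x} {y} x+n≤y y<x+2n eq = begin
    y          ≡⟨ m∸n+n≡m n≤y ⟨
    y ∸ n + n  ≡⟨ cong (_+ n) x≡y∸n ⟨
    x + n      ∎
    where
    open ≡-Reasoning
    n≤y : n ≤ y
    n≤y = ≤-trans (m≤n+m n x) x+n≤y
    x≡y∸n : x ≡ y ∸ n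
    x≡y∸n = []-injective-within-period
      (subst (x <_) (sym (m∸n+n≡m n≤y)) (<-≤-trans (m<m+n x (>-nonZero⁻¹ n)) x+n≤y))
      (+-cancelʳ-< n (y ∸ n) (x + n) (subst (_< x + n + n) (sym (m∸n+n≡m n≤y)) y<x+2n))
      (trans eq (sym ([]-cong (m≤n⇒[n∸m]%m≡n%m n≤y))))

  []-within-two-periods : ∀ {x y} → x < y + n + n → y < x + n + n → [ x ] ≡ [ y ] →
                          x ≡ y ⊎ y ≡ x + n ⊎ x ≡ y + n
  []-within-two-periods {x} {y} x<y+2n y<x+2n eq with x <? y + n | y <? x + n
  ... | yes x<y+n | yes y<x+n = inj₁ ([]-injective-within-period x<y+n y<x+n eq)
  ... | _         | no y≮x+n  = inj₂ (inj₁ ([]-beyond-one-period (≮⇒≥ y≮x+n) y<x+2n eq))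
  ... | no x≮y+n  | yes _     = inj₂ (inj₂ ([]-beyond-one-period (≮⇒≥ x≮y+n) x<y+2n (sym eq)))

  []-suc-distinct : 2 ≤ n → ∀ x → [ x ] ≢ [ suc x ]
  []-suc-distinct 2≤n x eq = 1+n≢n (sym ([]-injective-within-period
    (<-≤-trans (n<1+n x) (m≤m+n (suc x) n))
    (subst (_≤ x + n) (+-comm x 2) (+-monoʳ-≤ x 2≤n))
    eq))

  ⊕c-[] : ∀ a b c a′ b′ c′ →
          ([ a ] , [ b ] , [ c ]) ⊕c ([ a′ ] , [ b′ ] , [ c′ ]) ≡ ([ a + a′ ] , [ b + b′ ] , [ c + c′ ])
  ⊕c-[] a b c a′ b′ c′ = cong₂ _,_ ([]-+ a a′) (cong₂ _,_ ([]-+ b b′) ([]-+ c c′))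

  diagCell-[] : ∀ d r → diagCell [ d ] [ r ] ≡ ([ r ] , [ r + d ] , [ r + r + d ])
  diagCell-[] d r = cong₂ (λ c s → [ r ] , c , s)
    ([]-+ r d) (trans (cong (_⊕ [ d ]) ([]-+ r r)) ([]-+ (r + r) d))

rowColEdge-sym : ∀ {n} {x y : Cell n} → RowColEdge x y → RowColEdge y x
rowColEdge-sym (x≢y , inj₁ (r , c , s)) = ≢-sym x≢y , inj₁ (sym r , ≢-sym c , ≢-sym s)
rowColEdge-sym (x≢y , inj₂ (r , c , s)) = ≢-sym x≢y , inj₂ (≢-sym r , sym c , ≢-sym s)

module Cells (n : ℕ) .{{_ : NonZero n}} (i : Fin n) where

  cellAt : ℕ → Cell n
  cellAt a = [ ⌊ a /2⌋ ] , [ ⌈ a /2⌉ + toℕ i ] , [ a + toℕ i ]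

  cellAt-even : ∀ r → cellAt (r + r) ≡ ([ r ] , [ r + toℕ i ] , [ r + r + toℕ i ])
  cellAt-even r = cong₂ (λ p q → [ p ] , [ q + toℕ i ] , [ r + r + toℕ i ])
    (sym (n≡⌊n+n/2⌋ r)) (sym (n≡⌈n+n/2⌉ r))

  cellAt-odd : ∀ r → cellAt (suc (r + r)) ≡ ([ r ] , [ suc r + toℕ i ] , [ suc (r + r) + toℕ i ])
  cellAt-odd r = cong₂ (λ p q → [ p ] , [ suc q + toℕ i ] , [ suc (r + r) + toℕ i ])
    (sym (n≡⌈n+n/2⌉ r)) (sym (n≡⌊n+n/2⌋ r))

  diagCell-Tᵢ : ∀ r → diagCell i [ r ] ≡ ([ r ] , [ r + toℕ i ] , [ r + r + toℕ i ])
  diagCell-Tᵢ r = trans (cong (λ d → diagCell d [ r ]) (sym ([toℕ] i))) (diagCell-[] (toℕ i) r)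

  diagCell-Tᵢ₊₁ : ∀ r → diagCell (i ⊕ [ 1 ]) [ r ] ≡ ([ r ] , [ suc r + toℕ i ] , [ suc (r + r) + toℕ i ])
  diagCell-Tᵢ₊₁ r = begin
    diagCell (i ⊕ [ 1 ]) [ r ]          ≡⟨ cong (λ d → diagCell (d ⊕ [ 1 ]) [ r ]) ([toℕ] i) ⟨
    diagCell ([ toℕ i ] ⊕ [ 1 ]) [ r ]  ≡⟨ cong (λ d → diagCell d [ r ]) ([]-+ (toℕ i) 1) ⟩
    diagCell [ toℕ i + 1 ] [ r ]        ≡⟨ diagCell-[] (toℕ i + 1) r ⟩
    ([ r ] , [ r + (toℕ i + 1) ] , [ r + r + (toℕ i + 1) ])
      ≡⟨ cong₂ (λ c s → [ r ] , [ c ] , [ s ]) (shift r (toℕ i)) (shift (r + r) (toℕ i)) ⟩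
    ([ r ] , [ suc r + toℕ i ] , [ suc (r + r) + toℕ i ]) ∎
    where
    open ≡-Reasoning
    shift : ∀ x t → x + (t + 1) ≡ suc x + t
    shift = solve-∀

  cellAt-diagonal : ∀ a → InT i (cellAt a) ⊎ InT (i ⊕ [ 1 ]) (cellAt a)
  cellAt-diagonal a with parity a
  ... | even r = inj₁ ([ r ] , trans (cellAt-even r) (sym (diagCell-Tᵢ r)))
  ... | odd r  = inj₂ ([ r ] , trans (cellAt-odd r) (sym (diagCell-Tᵢ₊₁ r)))

  Tᵢ⊆cellAt : ∀ {x} → InT i x → ∃ λ a → cellAt a ≡ x
  Tᵢ⊆cellAt (s , refl) = toℕ s + toℕ s , (begin
    cellAt (toℕ s + toℕ s)  ≡⟨ cellAt-even (toℕ s) ⟩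
    _                       ≡⟨ diagCell-Tᵢ (toℕ s) ⟨
    diagCell i [ toℕ s ]    ≡⟨ cong (diagCell i) ([toℕ] s) ⟩
    diagCell i s            ∎)
    where open ≡-Reasoning

  Tᵢ₊₁⊆cellAt : ∀ {x} → InT (i ⊕ [ 1 ]) x → ∃ λ a → cellAt a ≡ x
  Tᵢ₊₁⊆cellAt (s , refl) = suc (toℕ s + toℕ s) , (begin
    cellAt (suc (toℕ s + toℕ s))    ≡⟨ cellAt-odd (toℕ s) ⟩
    _                               ≡⟨ diagCell-Tᵢ₊₁ (toℕ s) ⟨
    diagCell (i ⊕ [ 1 ]) [ toℕ s ]  ≡⟨ cong (diagCell (i ⊕ [ 1 ])) ([toℕ] s) ⟩
    diagCell (i ⊕ [ 1 ]) s          ∎)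
    where open ≡-Reasoning

  cellAt-periodic : ∀ q b → cellAt ((q * n + q * n) + b) ≡ cellAt b
  cellAt-periodic q b = cong₂ _,_ row≡ (cong₂ _,_ col≡ sym≡)
    where
    M : ℕ
    M = q * n
    row≡ : [ ⌊ (M + M) + b /2⌋ ] ≡ [ ⌊ b /2⌋ ]
    row≡ = trans (cong [_] (⌊[n+n]+m/2⌋≡n+⌊m/2⌋ M b)) ([]-*n+ q ⌊ b /2⌋)
    col≡ : [ ⌈ (M + M) + b /2⌉ + toℕ i ] ≡ [ ⌈ b /2⌉ + toℕ i ]
    col≡ = begin
      [ ⌊ suc ((M + M) + b) /2⌋ + toℕ i ]  ≡⟨ cong (λ x → [ ⌊ x /2⌋ + toℕ i ]) (+-suc (M + M) b) ⟨
      [ ⌊ (M + M) + suc b /2⌋ + toℕ i ]    ≡⟨ cong (λ x → [ x + toℕ i ]) (⌊[n+n]+m/2⌋≡n+⌊m/2⌋ M (suc b)) ⟩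
      [ M + ⌈ b /2⌉ + toℕ i ]              ≡⟨ cong [_] (+-assoc M ⌈ b /2⌉ (toℕ i)) ⟩
      [ M + (⌈ b /2⌉ + toℕ i) ]            ≡⟨ []-*n+ q _ ⟩
      [ ⌈ b /2⌉ + toℕ i ]                  ∎
      where open ≡-Reasoning
    sym≡ : [ (M + M) + b + toℕ i ] ≡ [ b + toℕ i ]
    sym≡ = begin
      [ (M + M) + b + toℕ i ]        ≡⟨ cong [_] (+-assoc (M + M) b (toℕ i)) ⟩
      [ (M + M) + (b + toℕ i) ]      ≡⟨ cong (λ x → [ x + (b + toℕ i) ]) (*-distribʳ-+ n q q) ⟨
      [ (q + q) * n + (b + toℕ i) ]  ≡⟨ []-*n+ (q + q) (b + toℕ i) ⟩
      [ b + toℕ i ]                  ∎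
      where open ≡-Reasoning

  cellAt-even-⊕c : ∀ r u →
    cellAt (r + r) ⊕c ([ u ] , [ suc u ] , [ suc (u + u) ]) ≡ cellAt (r + r + suc (u + u))
  cellAt-even-⊕c r u = begin
    cellAt (r + r) ⊕c ([ u ] , [ suc u ] , [ suc (u + u) ])
      ≡⟨ cong (_⊕c ([ u ] , [ suc u ] , [ suc (u + u) ])) (cellAt-even r) ⟩
    ([ r ] , [ r + t ] , [ r + r + t ]) ⊕c ([ u ] , [ suc u ] , [ suc (u + u) ])
      ≡⟨ ⊕c-[] r (r + t) (r + r + t) u (suc u) (suc (u + u)) ⟩
    ([ r + u ] , [ r + t + suc u ] , [ r + r + t + suc (u + u) ])
      ≡⟨ cong₂ (λ c s → [ r + u ] , [ c ] , [ s ]) (col-shift r u t) (sym-shift r u t) ⟩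
    ([ r + u ] , [ suc (r + u) + t ] , [ suc ((r + u) + (r + u)) + t ])
      ≡⟨ cellAt-odd (r + u) ⟨
    cellAt (suc ((r + u) + (r + u)))
      ≡⟨ cong cellAt (vertex-shift r u) ⟩
    cellAt (r + r + suc (u + u)) ∎
    where
    open ≡-Reasoning
    t : ℕ
    t = toℕ i
    col-shift : ∀ r u t → r + t + suc u ≡ suc (r + u) + t
    col-shift = solve-∀
    sym-shift : ∀ r u t → r + r + t + suc (u + u) ≡ suc ((r + u) + (r + u)) + t
    sym-shift = solve-∀
    vertex-shift : ∀ r u → suc ((r + u) + (r + u)) ≡ r + r + suc (u + u)
    vertex-shift = solve-∀

module Ladder (n : ℕ) .{{_ : NonZero n}} (2≤n : 2 ≤ n) (i : Fin n) where

  open Cells n i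

  private instance
    nonZero-n+n : NonZero (n + n)
    nonZero-n+n = nz+ n

  φ : Fin (n + n) → Cell n
  φ j = cellAt (toℕ j)

  φ-modN : ∀ a → φ (modN n a) ≡ cellAt a
  φ-modN a = begin
    cellAt (toℕ (modN n a))               ≡⟨ cong cellAt (toℕ[] a) ⟩
    cellAt (a % (n + n))                  ≡⟨ cellAt-periodic q (a % (n + n)) ⟨
    cellAt (q * n + q * n + a % (n + n))  ≡⟨ cong cellAt decomposition ⟩
    cellAt a                              ∎
    where
    open ≡-Reasoning
    q : ℕ
    q = a / (n + n)
    decomposition : q * n + q * n + a % (n + n) ≡ a
    decomposition = begin
      q * n + q * n + a % (n + n)  ≡⟨ cong (_+ a % (n + n)) (*-distribˡ-+ q n n) ⟨
      q * (n + n) + a % (n + n)    ≡⟨ +-comm _ (a % (n + n)) ⟩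
      a % (n + n) + q * (n + n)    ≡⟨ m≡m%n+[m/n]*n a (n + n) ⟨
      a                            ∎

  rowColEdge-suc : ∀ a → RowColEdge (cellAt a) (cellAt (suc a))
  rowColEdge-suc a = syms≢ ∘ cong symbol , edge (⌈n/2⌉≡⌊n/2⌋⊎⌈n/2⌉≡1+⌊n/2⌋ a)
    where
    syms≢ : [ a + toℕ i ] ≢ [ suc a + toℕ i ]
    syms≢ = []-suc-distinct 2≤n (a + toℕ i)
    edge : ⌈ a /2⌉ ≡ ⌊ a /2⌋ ⊎ ⌈ a /2⌉ ≡ suc ⌊ a /2⌋ →
           RowEdge (cellAt a) (cellAt (suc a)) ⊎ ColEdge (cellAt a) (cellAt (suc a))
    edge (inj₁ ⌈a/2⌉≡⌊a/2⌋) = inj₁ (cong [_] (sym ⌈a/2⌉≡⌊a/2⌋) , cols≢ , syms≢)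
      where
      cols≢ : [ ⌈ a /2⌉ + toℕ i ] ≢ [ suc ⌊ a /2⌋ + toℕ i ]
      cols≢ = []-suc-distinct 2≤n _ ∘ subst (λ c → [ c + toℕ i ] ≡ [ suc ⌊ a /2⌋ + toℕ i ]) ⌈a/2⌉≡⌊a/2⌋
    edge (inj₂ ⌈a/2⌉≡1+⌊a/2⌋) = inj₂ (rows≢ , cong (λ c → [ c + toℕ i ]) ⌈a/2⌉≡1+⌊a/2⌋ , syms≢)
      where
      rows≢ : [ ⌊ a /2⌋ ] ≢ [ ⌈ a /2⌉ ]
      rows≢ = []-suc-distinct 2≤n _ ∘ subst (λ c → [ ⌊ a /2⌋ ] ≡ [ c ]) ⌈a/2⌉≡1+⌊a/2⌋

  symEdge-+n : ∀ a → SymEdge (cellAt a) (cellAt (a + n))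
  symEdge-+n a =
    halves≢ a ,
    halves≢ (suc a) ∘ []-+-cancelʳ (toℕ i) ,
    sym (trans (cong [_] (+-right-comm a n (toℕ i))) ([]-+n (a + toℕ i)))
    where
    +-right-comm : ∀ x y z → x + y + z ≡ x + z + y
    +-right-comm = solve-∀
    halves≢ : ∀ b → [ ⌊ b /2⌋ ] ≢ [ ⌊ b + n /2⌋ ]
    halves≢ b eq with ⌊m/2⌋<⌊m+n/2⌋<⌊m/2⌋+n b 2≤n
    ... | lower , upper = <⇒≢ lower ([]-injective-within-period
          (<-≤-trans lower (m≤m+n _ n)) upper eq)

  rim-suc : ∀ (j k : Fin (n + n)) → toℕ k ≡ suc (toℕ j) → Rim n j k
  rim-suc j k k≡1+j = inj₁ (toℕ≡%⇒≡[] k (toℕ j + 1) (begin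
    toℕ k                    ≡⟨ k≡1+j ⟩
    suc (toℕ j)              ≡⟨ m<n⇒m%n≡m (subst (_< n + n) k≡1+j (toℕ<n k)) ⟨
    suc (toℕ j) % (n + n)    ≡⟨ cong (_% (n + n)) (+-comm 1 (toℕ j)) ⟩
    (toℕ j + 1) % (n + n)    ∎))
    where open ≡-Reasoning

  rim-wrap : ∀ (j k : Fin (n + n)) → toℕ j ≡ 0 → suc (toℕ k) ≡ n + n → Rim n j k
  rim-wrap j k j≡0 1+k≡2n = inj₂ (toℕ≡%⇒≡[] j (toℕ k + 1)
    (trans j≡0 (sym (trans (cong (_% (n + n)) (trans (+-comm (toℕ k) 1) 1+k≡2n)) (n%n≡0 (n + n))))))

  rim-sym : ∀ {j k} → Rim n j k → Rim n k j
  rim-sym = Sum.swap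

  rung-+n : ∀ (j k : Fin (n + n)) → toℕ k ≡ toℕ j + n → Rung n j k
  rung-+n j k k≡j+n = toℕ≡%⇒≡[] k (toℕ j + n)
    (trans k≡j+n (sym (m<n⇒m%n≡m (subst (_< n + n) k≡j+n (toℕ<n k)))))

  rung-∸n : ∀ (j k : Fin (n + n)) → toℕ j ≡ toℕ k + n → Rung n j k
  rung-∸n j k j≡k+n = toℕ≡%⇒≡[] k (toℕ j + n) (sym (begin
    (toℕ j + n) % (n + n)        ≡⟨ cong (λ x → (x + n) % (n + n)) j≡k+n ⟩
    (toℕ k + n + n) % (n + n)    ≡⟨ cong (_% (n + n)) (+-assoc (toℕ k) n n) ⟩
    (toℕ k + (n + n)) % (n + n)  ≡⟨ [m+n]%n≡m%n (toℕ k) (n + n) ⟩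
    toℕ k % (n + n)              ≡⟨ m<n⇒m%n≡m (toℕ<n k) ⟩
    toℕ k                        ∎))
    where open ≡-Reasoning

  <n+n⇒<o+n+n : ∀ {a} b → a < n + n → a < b + n + n
  <n+n⇒<o+n+n {a} b a<2n = subst (a <_) (sym (+-assoc b n n)) (m≤n⇒m≤o+n b a<2n)

  ≡⊎consecutive⇒≡⊎rim : ∀ (j k : Fin (n + n)) →
                        toℕ j ≡ toℕ k ⊎ toℕ k ≡ suc (toℕ j) ⊎ toℕ j ≡ suc (toℕ k) → j ≡ k ⊎ Rim n j k
  ≡⊎consecutive⇒≡⊎rim j k (inj₁ j≡k)          = inj₁ (toℕ-injective j≡k)
  ≡⊎consecutive⇒≡⊎rim j k (inj₂ (inj₁ k≡1+j)) = inj₂ (rim-suc j k k≡1+j)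
  ≡⊎consecutive⇒≡⊎rim j k (inj₂ (inj₂ j≡1+k)) = inj₂ (rim-sym (rim-suc k j j≡1+k))

  rows-agree : ∀ j k → row (φ j) ≡ row (φ k) → j ≡ k ⊎ Rim n j k
  rows-agree j k eq = ≡⊎consecutive⇒≡⊎rim j k (⌊m/2⌋≡⌊n/2⌋⇒m≡n⊎n≡1+m⊎m≡1+n (toℕ j) (toℕ k)
    ([]-injective-below (m<n+n⇒⌊m/2⌋<n (toℕ<n j)) (m<n+n⇒⌊m/2⌋<n (toℕ<n k)) eq))

  -- Columns also agree across the wrap-around: vertex 0 has column i, vertex 2n-1 has column n+i.
  cols-agree : ∀ j k → col (φ j) ≡ col (φ k) → j ≡ k ⊎ Rim n j k
  cols-agree j k eq = cases ([]-within-two-periods (bound j k) (bound k j) ([]-+-cancelʳ (toℕ i) eq))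
    where
    bound : ∀ (a b : Fin (n + n)) → ⌈ toℕ a /2⌉ < ⌈ toℕ b /2⌉ + n + n
    bound a b = <n+n⇒<o+n+n ⌈ toℕ b /2⌉ (≤-<-trans (m≤n+n⇒⌊m/2⌋≤n (toℕ<n a)) (m<m+n n (>-nonZero⁻¹ n)))
    cases : ⌈ toℕ j /2⌉ ≡ ⌈ toℕ k /2⌉ ⊎ ⌈ toℕ k /2⌉ ≡ ⌈ toℕ j /2⌉ + n ⊎ ⌈ toℕ j /2⌉ ≡ ⌈ toℕ k /2⌉ + n →
            j ≡ k ⊎ Rim n j k
    cases (inj₁ same) = ≡⊎consecutive⇒≡⊎rim j k
      (Sum.map suc-injective (Sum.map suc-injective suc-injective)
        (⌊m/2⌋≡⌊n/2⌋⇒m≡n⊎n≡1+m⊎m≡1+n (suc (toℕ j)) (suc (toℕ k)) same))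
    cases (inj₂ (inj₁ apart)) =
      inj₂ (uncurry (rim-wrap j k) (⌈n/2⌉≡⌈m/2⌉+k⇒m≡0×1+n≡k+k (toℕ<n k) apart))
    cases (inj₂ (inj₂ apart)) =
      inj₂ (rim-sym (uncurry (rim-wrap k j) (⌈n/2⌉≡⌈m/2⌉+k⇒m≡0×1+n≡k+k (toℕ<n j) apart)))

  syms-agree : ∀ j k → symbol (φ j) ≡ symbol (φ k) → j ≡ k ⊎ Rung n j k
  syms-agree j k eq
    with []-within-two-periods (<n+n⇒<o+n+n (toℕ k) (toℕ<n j)) (<n+n⇒<o+n+n (toℕ j) (toℕ<n k))
                               ([]-+-cancelʳ (toℕ i) eq)
  ... | inj₁ j≡k          = inj₁ (toℕ-injective j≡k)
  ... | inj₂ (inj₁ k≡j+n) = inj₂ (rung-+n j k k≡j+n)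
  ... | inj₂ (inj₂ j≡k+n) = inj₂ (rung-∸n j k j≡k+n)

  φ-next : ∀ (j : Fin (n + n)) → φ (modN n (toℕ j + 1)) ≡ cellAt (suc (toℕ j))
  φ-next j = trans (φ-modN (toℕ j + 1)) (cong cellAt (+-comm (toℕ j) 1))

  rim⇒rowColEdge : ∀ (j k : Fin (n + n)) → Rim n j k → RowColEdge (φ j) (φ k)
  rim⇒rowColEdge j k (inj₁ refl) = subst (RowColEdge (φ j)) (sym (φ-next j)) (rowColEdge-suc (toℕ j))
  rim⇒rowColEdge j k (inj₂ refl) =
    rowColEdge-sym (subst (RowColEdge (φ k)) (sym (φ-next k)) (rowColEdge-suc (toℕ k)))

  discard-≡ : ∀ {j k : Fin (n + n)} {A : Set} → φ j ≢ φ k → j ≡ k ⊎ A → A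
  discard-≡ φj≢φk = [ (λ j≡k → contradiction (cong φ j≡k) φj≢φk) , id ]′

  rowColEdge⇒rim : ∀ j k → RowColEdge (φ j) (φ k) → Rim n j k
  rowColEdge⇒rim j k (φj≢φk , edge) = discard-≡ φj≢φk (agree edge)
    where
    agree : RowEdge (φ j) (φ k) ⊎ ColEdge (φ j) (φ k) → j ≡ k ⊎ Rim n j k
    agree (inj₁ (rows , _)) = rows-agree j k rows
    agree (inj₂ (_ , cols , _)) = cols-agree j k cols

  rung⇒symEdge : ∀ (j k : Fin (n + n)) → Rung n j k → SymEdge (φ j) (φ k)
  rung⇒symEdge j k refl = subst (SymEdge (φ j)) (sym (φ-modN (toℕ j + n))) (symEdge-+n (toℕ j))

  adj⇔ladderAdj : ∀ j k → Adj (φ j) (φ k) ⇔ MLAdj n j k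
  adj⇔ladderAdj j k = mk⇔ to from
    where
    to : Adj (φ j) (φ k) → MLAdj n j k
    to (φj≢φk , inj₁ r)                       = inj₁ (rowColEdge⇒rim j k (φj≢φk , inj₁ r))
    to (φj≢φk , inj₂ (inj₁ c))                = inj₁ (rowColEdge⇒rim j k (φj≢φk , inj₂ c))
    to (φj≢φk , inj₂ (inj₂ (_ , _ , syms)))  = inj₂ (discard-≡ φj≢φk (syms-agree j k syms))
    from : MLAdj n j k → Adj (φ j) (φ k)
    from (inj₁ rim) with rim⇒rowColEdge j k rim
    ... | φj≢φk , edge = φj≢φk , Sum.map₂ inj₁ edge
    from (inj₂ rung) with rung⇒symEdge j k rung
    ... | edge@(rows≢ , _) = rows≢ ∘ cong row , inj₂ (inj₂ edge)

  φ-injective : ∀ j k → φ j ≡ φ k → j ≡ k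
  φ-injective j k φj≡φk = [ id , (λ rim → contradiction φj≡φk (proj₁ (rim⇒rowColEdge j k rim))) ]′
    (rows-agree j k (cong row φj≡φk))

  cellAt-odd∉Tᵢ : ∀ r → ¬ InT i (cellAt (suc (r + r)))
  cellAt-odd∉Tᵢ r (s , eq) = []-suc-distinct 2≤n r (trans rows (sym ([]-+-cancelʳ (toℕ i) cols)))
    where
    same : ([ r ] , [ suc r + toℕ i ] , [ suc (r + r) + toℕ i ]) ≡
           ([ toℕ s ] , [ toℕ s + toℕ i ] , [ toℕ s + toℕ s + toℕ i ])
    same = trans (sym (cellAt-odd r))
      (trans eq (trans (cong (diagCell i) (sym ([toℕ] s))) (diagCell-Tᵢ (toℕ s))))
    rows : [ r ] ≡ [ toℕ s ]
    rows = cong proj₁ same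
    cols : [ suc r + toℕ i ] ≡ [ toℕ s + toℕ i ]
    cols = cong (proj₁ ∘ proj₂) same

  Tᵢ⇒even : ∀ {a} → InT i (cellAt a) → ∃ λ r → a ≡ r + r
  Tᵢ⇒even {a} a∈Tᵢ with parity a
  ... | even r = r , refl
  ... | odd r  = contradiction a∈Tᵢ (cellAt-odd∉Tᵢ r)

  rimDist-shift : ∀ (j : Fin (n + n)) e → e < n + n → rimDist n j (modN n (toℕ j + e)) ≡ e ⊓ (n + n ∸ e)
  rimDist-shift j e e<2n = cong (λ d → d ⊓ (n + n ∸ d)) (begin
    toℕ (modN n (toℕ (modN n (toℕ j + e)) + (n + n ∸ toℕ j)))  ≡⟨ toℕ[] _ ⟩
    (toℕ (modN n (toℕ j + e)) + (n + n ∸ toℕ j)) % (n + n)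
      ≡⟨ cong (λ x → (x + (n + n ∸ toℕ j)) % (n + n)) (toℕ[] _) ⟩
    ((toℕ j + e) % (n + n) + (n + n ∸ toℕ j)) % (n + n)        ≡⟨ %-absorbˡ {n + n} (toℕ j + e) _ ⟩
    (toℕ j + e + (n + n ∸ toℕ j)) % (n + n)                    ≡⟨ cong (_% (n + n)) rotate ⟩
    (e + (n + n)) % (n + n)                                    ≡⟨ [m+n]%n≡m%n e (n + n) ⟩
    e % (n + n)                                                ≡⟨ m<n⇒m%n≡m e<2n ⟩
    e                                                          ∎)
    where
    open ≡-Reasoning
    rotate : toℕ j + e + (n + n ∸ toℕ j) ≡ e + (n + n)
    rotate = begin
      toℕ j + e + (n + n ∸ toℕ j)    ≡⟨ cong (_+ (n + n ∸ toℕ j)) (+-comm (toℕ j) e) ⟩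
      e + toℕ j + (n + n ∸ toℕ j)    ≡⟨ +-assoc e (toℕ j) _ ⟩
      e + (toℕ j + (n + n ∸ toℕ j))  ≡⟨ cong (e +_) (m+[n∸m]≡n (<⇒≤ (toℕ<n j))) ⟩
      e + (n + n)                    ∎

  φ≡shift⇒nearlyAntipodal : ∀ (j k : Fin (n + n)) e → e < n + n → e ⊓ (n + n ∸ e) ≡ n ∸ 1 →
                            φ k ≡ cellAt (toℕ j + e) → NearlyAntipodal n j k
  φ≡shift⇒nearlyAntipodal j k e e<2n e⊓≡ φk≡ = subst (NearlyAntipodal n j) (sym k≡)
    (trans (rimDist-shift j e e<2n) e⊓≡)
    where
    k≡ : k ≡ modN n (toℕ j + e)
    k≡ = φ-injective k _ (trans φk≡ (sym (φ-modN (toℕ j + e))))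

  nearlyAntipodal₁ : ∀ m → n ≡ m + m → ∀ j k → InT i (φ j) →
                     φ k ≡ φ j ⊕c ([ m ] , [ m + 1 ] , [ 1 ]) → NearlyAntipodal n j k
  nearlyAntipodal₁ m n≡2m j k j∈Tᵢ φk≡ with Tᵢ⇒even j∈Tᵢ
  ... | r , j≡2r = φ≡shift⇒nearlyAntipodal j k (n + 1) (+-monoʳ-< n 2≤n) ⊓-value (begin
    φ k
      ≡⟨ φk≡ ⟩
    φ j ⊕c ([ m ] , [ m + 1 ] , [ 1 ])
      ≡⟨ cong₂ (λ a b → cellAt a ⊕c ([ m ] , [ b ] , [ 1 ])) j≡2r (+-comm m 1) ⟩
    cellAt (r + r) ⊕c ([ m ] , [ suc m ] , [ 1 ])
      ≡⟨ cong (λ c → cellAt (r + r) ⊕c ([ m ] , [ suc m ] , c)) [1]≡ ⟩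
    cellAt (r + r) ⊕c ([ m ] , [ suc m ] , [ suc (m + m) ])
      ≡⟨ cellAt-even-⊕c r m ⟩
    cellAt (r + r + suc (m + m))
      ≡⟨ cong₂ (λ a b → cellAt (a + b)) j≡2r (trans (+-comm n 1) (cong suc n≡2m)) ⟨
    cellAt (toℕ j + (n + 1)) ∎)
    where
    open ≡-Reasoning
    [1]≡ : [ 1 ] ≡ [ suc (m + m) ]
    [1]≡ = sym (trans (cong (λ x → [ suc x ]) (sym n≡2m)) ([]-+n 1))
    ⊓-value : (n + 1) ⊓ (n + n ∸ (n + 1)) ≡ n ∸ 1
    ⊓-value = trans (cong ((n + 1) ⊓_) ([m+n]∸[m+o]≡n∸o n n 1))
                    (m≥n⇒m⊓n≡n (≤-trans (m∸n≤m n 1) (m≤m+n n 1)))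

  nearlyAntipodal₂ : ∀ m → n ≡ m + m → ∀ j k → InT i (φ j) →
                     φ k ≡ φ j ⊕c ([ m ∸ 1 ] , [ m ] , [ n ∸ 1 ]) → NearlyAntipodal n j k
  nearlyAntipodal₂ zero    n≡0   = contradiction (subst (2 ≤_) n≡0 2≤n) λ ()
  nearlyAntipodal₂ (suc u) n≡2m j k j∈Tᵢ φk≡ with Tᵢ⇒even j∈Tᵢ
  ... | r , j≡2r = φ≡shift⇒nearlyAntipodal j k (n ∸ 1) n∸1<2n ⊓-value (begin
    φ k
      ≡⟨ φk≡ ⟩
    φ j ⊕c ([ u ] , [ suc u ] , [ n ∸ 1 ])
      ≡⟨ cong₂ (λ a c → cellAt a ⊕c ([ u ] , [ suc u ] , [ c ])) j≡2r n∸1≡ ⟩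
    cellAt (r + r) ⊕c ([ u ] , [ suc u ] , [ suc (u + u) ])
      ≡⟨ cellAt-even-⊕c r u ⟩
    cellAt (r + r + suc (u + u))
      ≡⟨ cong₂ (λ a b → cellAt (a + b)) j≡2r n∸1≡ ⟨
    cellAt (toℕ j + (n ∸ 1)) ∎)
    where
    open ≡-Reasoning
    n∸1≡ : n ∸ 1 ≡ suc (u + u)
    n∸1≡ = trans (cong (_∸ 1) n≡2m) (+-suc u u)
    n∸1<2n : n ∸ 1 < n + n
    n∸1<2n = ≤-<-trans (m∸n≤m n 1) (m<m+n n (>-nonZero⁻¹ n))
    ⊓-value : (n ∸ 1) ⊓ (n + n ∸ (n ∸ 1)) ≡ n ∸ 1
    ⊓-value = m≤n⇒m⊓n≡m (≤-trans (m∸n≤m n 1)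
      (subst (_≤ n + n ∸ (n ∸ 1)) (m+n∸n≡m n n) (∸-monoʳ-≤ (n + n) (m∸n≤m n 1))))

  φ-onto-Tᵢ∪Tᵢ₊₁ : ∀ x → InT i x ⊎ InT (i ⊕ [ 1 ]) x → ∃ λ j → φ j ≡ x
  φ-onto-Tᵢ∪Tᵢ₊₁ x x∈T with [ Tᵢ⊆cellAt , Tᵢ₊₁⊆cellAt ]′ x∈T
  ... | a , cellAt-a≡x = modN n a , trans (φ-modN a) cellAt-a≡x

mainTheorem9 : (n : ℕ) .{{_ : NonZero n}} → 2 ≤ n → (i : Fin n) →
    Σ (Fin (n + n) → Cell n) λ φ →
      (∀ j k → φ j ≡ φ k → j ≡ k) ×
      (∀ j → InT i (φ j) ⊎ InT (i ⊕ [ 1 ]) (φ j)) ×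
      (∀ x → InT i x ⊎ InT (i ⊕ [ 1 ]) x → ∃ λ j → φ j ≡ x) ×
      (∀ j k → Adj (φ j) (φ k) ⇔ MLAdj n j k) ×
      (∀ j k → RowColEdge (φ j) (φ k) ⇔ Rim n j k) ×
      ((m : ℕ) → n ≡ m + m → ∀ j k → InT i (φ j) →
        (φ k ≡ φ j ⊕c ([ m ] , [ m + 1 ] , [ 1 ]) →
          NearlyAntipodal n j k) ×
        (φ k ≡ φ j ⊕c ([ m ∸ 1 ] , [ m ] , [ n ∸ 1 ]) →
          NearlyAntipodal n j k))
mainTheorem9 n 2≤n i =
  φ , φ-injective , cellAt-diagonal ∘ toℕ , φ-onto-Tᵢ∪Tᵢ₊₁ , adj⇔ladderAdj ,
  (λ j k → mk⇔ (rowColEdge⇒rim j k) (rim⇒rowColEdge j k)) ,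
  λ m n≡2m j k j∈Tᵢ → nearlyAntipodal₁ m n≡2m j k j∈Tᵢ , nearlyAntipodal₂ m n≡2m j k j∈Tᵢ
  where
  open Cells n i
  open Ladder n 2≤n i
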